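{- For each integer $r\geq 2$ there are unique functions $M_r,w_r:\mathbb{Z}_{\geq 2}^r\to\mathbb{Z}_{\geq 0}$ such that the family $(M_r,w_r)_{r\geq 2}$ satisfies the following properties: (i) $M_2(k_1,k_2)=\binom{k_1+k_2-2}{k_1-1}$ and $w_2(k_1,k_2)=0$ for all $k_1,k_2\geq 2$; (ii) for every $r\geq 2$, all $k_1,\dots,k_r\geq 2$, and every position, inserting a coordinate equal to $2$ into $(k_1,\dots,k_r)$ at that position gives an $(r+1)$-tuple at which $M_{r+1}$ equals $M_r(k_1,\dots,k_r)$ and $w_{r+1}$ equals $w_r(k_1,\dots,k_r)$; (iii) for every $r\geq 2$ and all $k_1,\dots,k_r\geq 3$, \[ M_r(k_1,\dots,k_r)=\sum_{i=1}^r M_r(k_1,\dots,k_i-1,\dots,k_r),\qquad w_r(k_1,\dots,k_r)=\sum_{i=1}^r w_r(k_1,\dots,k_i-1,\dots,k_r)+(r-2). \] Moreover, each $M_r$ and $w_r$ is invariant under permutation of its coordinates, and for all integers $r,k_1,\dots,k_r\geq 2$, \[ R_r(k_1,\dots,k_r)\leq M_r(k_1,\dots,k_r)-w_r(k_1,\dots,k_r). \]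
   Context: For integers $r\geq 1$ and $k_1,\dots,k_r\geq 1$, the Ramsey number $R_r(k_1,\dots,k_r)$ is the minimum $N\in\mathbb{N}$ such that every coloring of the edges of the complete graph $K_N$ with $r$ colors $1,\dots,r$ contains, for some $i$, a complete subgraph on $k_i$ vertices all of whose edges have color $i$. In (iii), $(k_1,\dots,k_i-1,\dots,k_r)$ denotes the tuple obtained by decreasing the $i$-th coordinate by $1$. -}

module Defs where

open import Data.Nat using (ℕ; zero; suc; _+_; _∸_; _≤_; pred)
open import Data.Nat.Combinatorics using (_C_)
open import Data.Fin using (Fin; zero; suc)
open import Data.Fin.Permutation using (Permutation′; _⟨$⟩ʳ_)
open import Data.Vec using (Vec; lookup; insertAt; updateAt; sum; tabulate)
open import Data.Vec.Relation.Unary.All using (All)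
open import Data.Product using (Σ; _×_; ∃)
open import Function.Definitions using (Injective)
open import Relation.Binary.PropositionalEquality using (_≡_; _≢_)

-- A family (M_r)_r of functions on r-tuples, tuples given as Vec ℕ r.
-- Only the values at r ≥ 2 and tuples with all coordinates ≥ 2 matter.
Family : Set
Family = (r : ℕ) → Vec ℕ r → ℕ

AllGe : ℕ → {r : ℕ} → Vec ℕ r → Set
AllGe m k = All (m ≤_) k

decAt : {r : ℕ} → Vec ℕ r → Fin r → Vec ℕ r
decAt k i = updateAt k i pred

Prop-i : Family → Family → Set
Prop-i M w = (k : Vec ℕ 2) → AllGe 2 k →
  (M 2 k ≡ ((lookup k zero + lookup k (suc zero) ∸ 2) C (lookup k zero ∸ 1)))
  × (w 2 k ≡ 0)

Prop-ii : Family → Family → Set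
Prop-ii M w = (r : ℕ) → 2 ≤ r → (k : Vec ℕ r) → AllGe 2 k → (p : Fin (suc r)) →
  (M (suc r) (insertAt k p 2) ≡ M r k) × (w (suc r) (insertAt k p 2) ≡ w r k)

Prop-iii : Family → Family → Set
Prop-iii M w = (r : ℕ) → 2 ≤ r → (k : Vec ℕ r) → AllGe 3 k →
  (M r k ≡ sum (tabulate (λ i → M r (decAt k i))))
  × (w r k ≡ sum (tabulate (λ i → w r (decAt k i))) + (r ∸ 2))

Satisfies : Family → Family → Set
Satisfies M w = Prop-i M w × Prop-ii M w × Prop-iii M w

permute : {r : ℕ} → Permutation′ r → Vec ℕ r → Vec ℕ r
permute π k = tabulate (λ i → lookup k (π ⟨$⟩ʳ i))

-- Ramsey numbers.  An r-coloring of the edges of K_N is a symmetric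
-- function c : Fin N → Fin N → Fin r (values on the diagonal are irrelevant).
SymColoring : ℕ → ℕ → Set
SymColoring N r = Σ (Fin N → Fin N → Fin r) (λ c → ∀ x y → c x y ≡ c y x)

HasMonoClique : {N r : ℕ} → Vec ℕ r → (Fin N → Fin N → Fin r) → Set
HasMonoClique {N} {r} k c =
  Σ (Fin r) λ i → Σ (Fin (lookup k i) → Fin N) λ f →
    Injective _≡_ _≡_ f × (∀ a b → a ≢ b → c (f a) (f b) ≡ i)

Arrows : (N r : ℕ) → Vec ℕ r → Set
Arrows N r k = (c : SymColoring N r) → HasMonoClique k (Σ.proj₁ c)

IsRamseyNumber : (r : ℕ) → Vec ℕ r → ℕ → Set
IsRamseyNumber r k N = Arrows N r k × ((N′ : ℕ) → Arrows N′ r k → N ≤ N′)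

-- Coordinates equal to 2 are inert by (ii), so M and w are computed on the list of
-- coordinates ≥ 3 by the recursion (iii); on lists of length 0 and 1 the values M = 2,
-- M = x and w = 0 are forced by (i) and (ii).  The recursion is symmetric in the list,
-- which gives permutation invariance, and uniqueness follows by induction on Σ k, since a
-- tuple either contains a 2 or has all coordinates ≥ 3.
--
-- Since M − w = Σᵢ (M − w)(k − eᵢ) − (r − 2), the function u = M − w − 1 satisfies
-- u = 1 + Σᵢ u(k − eᵢ), summed over the i with kᵢ ≥ 3.  The Erdős–Szekeres argument
-- (pigeonhole on the colours of the edges at one vertex) gives
-- R(k) ≤ 2 + Σᵢ (R(k − eᵢ) − 1), where the terms with kᵢ = 2 vanish, hence R(k) ≤ u + 1
-- by induction.  Arrowing is decidable by exhaustive search, so the least N with the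
-- arrowing property exists.

module Submission where

open import Defs
open import Data.Empty using (⊥-elim)
open import Data.Fin using (Fin; zero; suc; punchIn; lift)
open import Data.Fin.Permutation using (Permutation′; _⟨$⟩ʳ_; _⟨$⟩ˡ_; inverseʳ; remove; punchIn-permute′)
open import Data.Fin.Properties using (_≟_; suc-injective; lift-injective; any?; all?)
open import Data.List using (List; []; _∷_; [_]; _++_; map; filter; length)
open import Data.List.Properties
  using (map-∘; map-cong; map-cong-local; length-map; ++-identityʳ; length-++;
         filter-++; filter-accept; filter-reject; filter-all; length-filter)
open import Data.List.Relation.Unary.All as All using (All; []; _∷_)
open import Data.List.Relation.Unary.All.Properties using (map⁺; ++⁺; all-filter)
import Data.List.Relation.Binary.Permutation.Propositional as ↭
open ↭ using (_↭_; prep; swap; ↭-refl; ↭-reflexive; ↭-sym; ↭-trans)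
open import Data.List.Relation.Binary.Permutation.Propositional.Properties
  using (↭-length; ↭-empty-inv; ↭-singleton-inv; ++⁺ˡ; shift; filter-↭) renaming (map⁺ to ↭-map⁺)
open import Data.Nat using (ℕ; zero; suc; _+_; _∸_; _≤_; _<_; z≤n; s≤s; s≤s⁻¹; pred; >-nonZero)
open import Data.Nat.Combinatorics using (_C_; nC1≡n; nCk≡nC[n∸k]; nCk+nC[k+1]≡[n+1]C[k+1])
open import Data.Nat.Induction using (<-rec)
open import Data.Nat.ListAction using () renaming (sum to ∑)
open import Data.Nat.ListAction.Properties using (sum-↭)
open import Data.Nat.Properties
  using (_≤?_; ≤-refl; ≤-trans; ≤-reflexive; <-≤-trans; ≮⇒≥; n<1+n; n≤1+n; m<n+m;
         +-monoˡ-<; +-monoʳ-<; +-monoˡ-≤; +-identityʳ; +-comm; +-suc; m+n∸n≡m; m+n∸m≡n; suc-pred;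
         anyUpTo?; +-commutativeSemigroup)
open import Algebra.Properties.CommutativeSemigroup +-commutativeSemigroup using (x∙yz≈y∙xz; interchange)
open import Data.Nat.Tactic.RingSolver using (solve-∀)
open import Data.Product using (Σ; ∃; _×_; _,_; proj₁; proj₂)
open import Data.Sum using (_⊎_; inj₁; inj₂)
open import Data.Vec using (Vec; []; _∷_; lookup; insertAt; tabulate; toList; sum)
open import Data.Vec.Properties
  using (tabulate-cong; tabulate∘lookup; lookup∘tabulate; length-toList; lookup∘updateAt; lookup∘updateAt′)
open import Data.Vec.Relation.Unary.All as VAll using ([]; _∷_)
open import Data.Vec.Relation.Unary.All.Properties using (lookup⁺; toList⁺)
open import Data.Vec.Functional using (Vector; head; tail) renaming ([] to []ᶠ; _∷_ to _∷ᶠ_)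
open import Data.Vec.Functional.Relation.Binary.Pointwise using (Pointwise)
open import Function using (_∘_; id)
open import Function.Definitions using (Injective)
open import Relation.Nullary using (¬_; yes; no)
open import Relation.Nullary.Decidable using (Dec; map′; ¬?; _×-dec_; _→-dec_; decidable-stable)
open import Relation.Unary using (Decidable)
open import Relation.Binary.Definitions using (Reflexive; Symmetric; _Respects_)
open import Relation.Binary.PropositionalEquality hiding ([_])


-- Lists of coordinates and their lowerings

-- A tuple is represented by the list of its coordinates ≥ 3: by (ii), coordinates equal to 2
-- do not affect M and w.
keep3 : List ℕ → List ℕ
keep3 = filter (3 ≤?_)

canon : ∀ {r} → Vec ℕ r → List ℕ
canon k = keep3 (toList k)

lower : ℕ → List ℕ → List ℕ
lower x L = keep3 [ pred x ] ++ L

lowerings : List ℕ → List (List ℕ)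
lowerings []      = []
lowerings (x ∷ L) = lower x L ∷ map (x ∷_) (lowerings L)

size : List ℕ → ℕ
size L = ∑ (map suc L)

All≥3 : List ℕ → Set
All≥3 = All (3 ≤_)

keep3-∷ : ∀ x L → keep3 (x ∷ L) ≡ keep3 [ x ] ++ keep3 L
keep3-∷ x L = filter-++ (3 ≤?_) [ x ] L

size-lower : ∀ x L → size (lower x L) < size (x ∷ L)
size-lower x L with 3 ≤? pred x
size-lower (suc x) L | yes x≥3 rewrite filter-accept (3 ≤?_) {xs = []} x≥3 =
  +-monoˡ-< (size L) (n<1+n (suc x))
size-lower x       L | no x≱3 rewrite filter-reject (3 ≤?_) {xs = []} x≱3 =
  m<n+m (size L) (s≤s z≤n)

length-lower : ∀ x L → length (lower x L) ≤ suc (length L)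
length-lower x L = ≤-trans (≤-reflexive (length-++ (keep3 [ pred x ])))
                           (+-monoˡ-≤ (length L) (length-filter (3 ≤?_) [ pred x ]))

lowerings-smaller : ∀ L → All (λ D → size D < size L) (lowerings L)
lowerings-smaller []      = []
lowerings-smaller (x ∷ L) = size-lower x L ∷ map⁺ (All.map (+-monoʳ-< (suc x)) (lowerings-smaller L))

lowerings-all≥3 : ∀ {L} → All≥3 L → All All≥3 (lowerings L)
lowerings-all≥3 {[]}    []         = []
lowerings-all≥3 {x ∷ L} (x≥3 ∷ L≥3) =
  ++⁺ (all-filter (3 ≤?_) [ pred x ]) L≥3 ∷ map⁺ (All.map (x≥3 ∷_) (lowerings-all≥3 L≥3))

length-lowerings : ∀ L → length (lowerings L) ≡ length L
length-lowerings []      = refl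
length-lowerings (x ∷ L) = cong suc (trans (length-map (x ∷_) (lowerings L)) (length-lowerings L))

∑-map-∘ : ∀ {A B : Set} (F : B → ℕ) (g : A → B) xs → ∑ (map F (map g xs)) ≡ ∑ (map (F ∘ g) xs)
∑-map-∘ F g xs = cong ∑ (sym (map-∘ xs))

∑-map-+ : ∀ {A : Set} (f g : A → ℕ) xs → ∑ (map (λ x → f x + g x) xs) ≡ ∑ (map f xs) + ∑ (map g xs)
∑-map-+ f g []       = refl
∑-map-+ f g (x ∷ xs) = trans (cong (f x + g x +_) (∑-map-+ f g xs)) (interchange (f x) (g x) _ _)

∑-map-suc : ∀ {A : Set} (g : A → ℕ) xs → ∑ (map (suc ∘ g) xs) ≡ length xs + ∑ (map g xs)
∑-map-suc g []       = refl
∑-map-suc g (x ∷ xs) = cong suc (trans (cong (g x +_) (∑-map-suc g xs)) (x∙yz≈y∙xz (g x) (length xs) _))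

∑-lowerings-↭ : ∀ (F F′ : List ℕ → ℕ) → (∀ {A B} → A ↭ B → F A ≡ F′ B) →
                ∀ {L L′} → L ↭ L′ → ∑ (map F (lowerings L)) ≡ ∑ (map F′ (lowerings L′))
∑-lowerings-↭ F F′ F≈F′ {L} ↭.refl = cong ∑ (map-cong (λ D → F≈F′ ↭-refl) (lowerings L))
∑-lowerings-↭ F F′ F≈F′ (prep {L} {L′} x p) = cong₂ _+_ (F≈F′ (++⁺ˡ (keep3 [ pred x ]) p)) (begin
  ∑ (map F (map (x ∷_) (lowerings L)))    ≡⟨ ∑-map-∘ F (x ∷_) (lowerings L) ⟩
  ∑ (map (F ∘ (x ∷_)) (lowerings L))      ≡⟨ ∑-lowerings-↭ (F ∘ (x ∷_)) (F′ ∘ (x ∷_)) (F≈F′ ∘ prep x) p ⟩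
  ∑ (map (F′ ∘ (x ∷_)) (lowerings L′))    ≡⟨ ∑-map-∘ F′ (x ∷_) (lowerings L′) ⟨
  ∑ (map F′ (map (x ∷_) (lowerings L′)))  ∎)
  where open ≡-Reasoning
∑-lowerings-↭ F F′ F≈F′ (swap {L} {L′} x y p) = begin
  F a + (F b + ∑ (map F (map (x ∷_) (map (y ∷_) (lowerings L)))))
    ≡⟨ cong₂ (λ s t → s + (t + _)) (F≈F′ a↭d) (F≈F′ b↭c) ⟩
  F′ d + (F′ c + ∑ (map F (map (x ∷_) (map (y ∷_) (lowerings L)))))
    ≡⟨ cong (λ s → F′ d + (F′ c + s)) rest ⟩
  F′ d + (F′ c + ∑ (map F′ (map (y ∷_) (map (x ∷_) (lowerings L′)))))
    ≡⟨ x∙yz≈y∙xz (F′ d) (F′ c) _ ⟩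
  F′ c + (F′ d + ∑ (map F′ (map (y ∷_) (map (x ∷_) (lowerings L′)))))  ∎
  where
  open ≡-Reasoning
  a = lower x (y ∷ L)
  b = x ∷ lower y L
  c = lower y (x ∷ L′)
  d = y ∷ lower x L′
  a↭d : a ↭ d
  a↭d = ↭-trans (shift y (keep3 [ pred x ]) L) (prep y (++⁺ˡ (keep3 [ pred x ]) p))
  b↭c : b ↭ c
  b↭c = ↭-trans (prep x (++⁺ˡ (keep3 [ pred y ]) p)) (↭-sym (shift x (keep3 [ pred y ]) L′))
  rest : ∑ (map F (map (x ∷_) (map (y ∷_) (lowerings L))))
       ≡ ∑ (map F′ (map (y ∷_) (map (x ∷_) (lowerings L′))))
  rest = begin
    ∑ (map F (map (x ∷_) (map (y ∷_) (lowerings L))))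
      ≡⟨ ∑-map-∘ F (x ∷_) (map (y ∷_) (lowerings L)) ⟩
    ∑ (map (F ∘ (x ∷_)) (map (y ∷_) (lowerings L)))
      ≡⟨ ∑-map-∘ (F ∘ (x ∷_)) (y ∷_) (lowerings L) ⟩
    ∑ (map (λ D → F (x ∷ y ∷ D)) (lowerings L))
      ≡⟨ ∑-lowerings-↭ (λ D → F (x ∷ y ∷ D)) (λ D → F′ (y ∷ x ∷ D)) (F≈F′ ∘ swap x y) p ⟩
    ∑ (map (λ D → F′ (y ∷ x ∷ D)) (lowerings L′))
      ≡⟨ ∑-map-∘ (F′ ∘ (y ∷_)) (x ∷_) (lowerings L′) ⟨
    ∑ (map (F′ ∘ (y ∷_)) (map (x ∷_) (lowerings L′)))
      ≡⟨ ∑-map-∘ F′ (y ∷_) (map (x ∷_) (lowerings L′)) ⟨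
    ∑ (map F′ (map (y ∷_) (map (x ∷_) (lowerings L′))))  ∎
∑-lowerings-↭ F F′ F≈F′ (↭.trans p q) =
  trans (∑-lowerings-↭ F F (λ A↭B → trans (F≈F′ A↭B) (sym (F≈F′ ↭-refl))) p)
        (∑-lowerings-↭ F F′ F≈F′ q)

canon-all≥3 : ∀ {r} {k : Vec ℕ r} → AllGe 3 k → canon k ≡ toList k
canon-all≥3 k≥3 = filter-all (3 ≤?_) (toList⁺ k≥3)

canon-insert2 : ∀ {r} (k : Vec ℕ r) p → canon (insertAt k p 2) ≡ canon k
canon-insert2 k       zero    = refl
canon-insert2 (x ∷ k) (suc p) = begin
  keep3 (x ∷ toList (insertAt k p 2))  ≡⟨ keep3-∷ x _ ⟩
  keep3 [ x ] ++ canon (insertAt k p 2) ≡⟨ cong (keep3 [ x ] ++_) (canon-insert2 k p) ⟩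
  keep3 [ x ] ++ canon k                ≡⟨ keep3-∷ x _ ⟨
  canon (x ∷ k)                         ∎
  where open ≡-Reasoning

ifAbove2 : ℕ → ℕ → ℕ
ifAbove2 (suc (suc (suc _))) v = v
ifAbove2 _                   _ = 0

ifAbove2-≥3 : ∀ {x v} → 3 ≤ x → ifAbove2 x v ≡ v
ifAbove2-≥3 (s≤s (s≤s (s≤s _))) = refl

-- Lowering a coordinate ≤ 2 leaves the canonical list unchanged, so such terms get weight 0.
loweringWeight : (List ℕ → ℕ) → ∀ {r} → Vec ℕ r → Fin r → ℕ
loweringWeight F k i = ifAbove2 (lookup k i) (F (canon (decAt k i)))

sum-loweringWeight : ∀ F {r} (k : Vec ℕ r) → sum (tabulate (loweringWeight F k)) ≡ ∑ (map F (lowerings (canon k)))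
sum-loweringWeight F []                      = refl
sum-loweringWeight F (0 ∷ k)                 = sum-loweringWeight F k
sum-loweringWeight F (1 ∷ k)                 = sum-loweringWeight F k
sum-loweringWeight F (2 ∷ k)                 = sum-loweringWeight F k
sum-loweringWeight F (x@(suc (suc (suc _))) ∷ k) =
  cong₂ _+_ (cong F (keep3-∷ (pred x) (toList k)))
            (trans (sum-loweringWeight (F ∘ (x ∷_)) k) (sym (∑-map-∘ F (x ∷_) (lowerings (canon k)))))

loweringWeight-all≥3 : ∀ F {r} {k : Vec ℕ r} → AllGe 3 k → ∀ i → loweringWeight F k i ≡ F (canon (decAt k i))
loweringWeight-all≥3 F k≥3 i = ifAbove2-≥3 (lookup⁺ k≥3 i)


-- Recursion along lowerings

-- Recursion on fuel: the value 0 at fuel zero is junk, and any fuel above size L gives the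
-- intended value because lowering decreases size (recᶠ-fuel).
module LoweringRecursion (empty : ℕ) (single : ℕ → ℕ) (extra : ℕ → ℕ) where

  recᶠ : ℕ → List ℕ → ℕ
  recᶠ _       []                 = empty
  recᶠ _       (x ∷ [])           = single x
  recᶠ zero    (_ ∷ _ ∷ _)        = 0
  recᶠ (suc n) L@(_ ∷ _ ∷ L′)     = ∑ (map (recᶠ n) (lowerings L)) + extra (length L′)

  rec : List ℕ → ℕ
  rec L = recᶠ (suc (size L)) L

  recᶠ-fuel : ∀ m n L → size L < m → size L < n → recᶠ m L ≡ recᶠ n L
  recᶠ-fuel _       _       []          _          _          = refl
  recᶠ-fuel _       _       (_ ∷ [])    _          _          = refl
  recᶠ-fuel (suc m) (suc n) L@(_ ∷ _ ∷ L′) (s≤s L<m) (s≤s L<n) =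
    cong (λ s → ∑ s + extra (length L′)) (map-cong-local (All.map
      (λ {D} D<L → recᶠ-fuel m n D (<-≤-trans D<L L<m) (<-≤-trans D<L L<n)) (lowerings-smaller L)))

  rec-lowerings : ∀ x y L → rec (x ∷ y ∷ L) ≡ ∑ (map rec (lowerings (x ∷ y ∷ L))) + extra (length L)
  rec-lowerings x y L =
    cong (λ s → ∑ s + extra (length L)) (map-cong-local (All.map
      (λ {D} D<L → recᶠ-fuel _ _ D (≤-trans D<L (n<1+n _)) (n<1+n _)) (lowerings-smaller (x ∷ y ∷ L))))

  recᶠ-↭ : ∀ n {A B} → A ↭ B → recᶠ n A ≡ recᶠ n B
  recᶠ-↭ n {[]}    p with refl ← ↭-empty-inv (↭-sym p) = refl
  recᶠ-↭ n {_ ∷ []} p with refl ← ↭-singleton-inv (↭-sym p) = refl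
  recᶠ-↭ n {_ ∷ _ ∷ _} {[]}     p with () ← ↭-empty-inv p
  recᶠ-↭ n {_ ∷ _ ∷ _} {_ ∷ []} p with () ← ↭-singleton-inv p
  recᶠ-↭ zero    {_ ∷ _ ∷ _} {_ ∷ _ ∷ _} p = refl
  recᶠ-↭ (suc n) {_ ∷ _ ∷ _} {_ ∷ _ ∷ _} p =
    cong₂ _+_ (∑-lowerings-↭ (recᶠ n) (recᶠ n) (recᶠ-↭ n) p)
              (cong (extra ∘ pred ∘ pred) (↭-length p))

  rec-↭ : ∀ {A B} → A ↭ B → rec A ≡ rec B
  rec-↭ {A} {B} p = trans (recᶠ-↭ _ p) (recᶠ-fuel _ _ B (s≤s (≤-reflexive (sym size≡))) (n<1+n _))
    where size≡ : size A ≡ size B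
          size≡ = sum-↭ (↭-map⁺ suc p)

  rec-canon : ∀ {r} (k : Vec ℕ (2 + r)) → AllGe 3 k →
              rec (canon k) ≡ sum (tabulate (λ i → rec (canon (decAt k i)))) + extra r
  rec-canon {r} k@(x ∷ y ∷ k′) k≥3 = begin
    rec (canon k)                                          ≡⟨ cong rec (canon-all≥3 k≥3) ⟩
    rec (toList k)                                         ≡⟨ rec-lowerings x y (toList k′) ⟩
    ∑ (map rec (lowerings (toList k))) + extra (length (toList k′))
      ≡⟨ cong₂ (λ L n → ∑ (map rec (lowerings L)) + extra n) (canon-all≥3 k≥3) (sym (length-toList k′)) ⟨
    ∑ (map rec (lowerings (canon k))) + extra r            ≡⟨ cong (_+ extra r) (sum-loweringWeight rec k) ⟨
    sum (tabulate (loweringWeight rec k)) + extra r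
      ≡⟨ cong (λ v → sum v + extra r) (tabulate-cong (loweringWeight-all≥3 rec k≥3)) ⟩
    sum (tabulate (λ i → rec (canon (decAt k i)))) + extra r ∎
    where open ≡-Reasoning

module Mᶜ = LoweringRecursion 2 id (λ _ → 0)
module wᶜ = LoweringRecursion 0 (λ _ → 0) id
module uᶜ = LoweringRecursion 1 pred (λ _ → 1)

M w : Family
M _ k = Mᶜ.rec (canon k)
w _ k = wᶜ.rec (canon k)


-- Properties (i)–(iii) and symmetry

M-binomial : ∀ a b → Mᶜ.rec (canon (2 + a ∷ 2 + b ∷ [])) ≡ (a + (2 + b)) C (suc a)
M-binomial zero    zero    = sym (nC1≡n 2)
M-binomial zero    (suc b) = sym (nC1≡n (3 + b))
M-binomial (suc a) zero    = begin
  3 + a                    ≡⟨ nC1≡n (3 + a) ⟨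
  (3 + a) C 1              ≡⟨ cong ((3 + a) C_) (m+n∸n≡m 1 (2 + a)) ⟨
  (3 + a) C (3 + a ∸ (2 + a)) ≡⟨ nCk≡nC[n∸k] (n≤1+n (2 + a)) ⟨
  (3 + a) C (2 + a)        ≡⟨ cong (λ n → suc n C (2 + a)) (+-comm 2 a) ⟩
  (suc a + 2) C (2 + a)    ∎
  where open ≡-Reasoning
M-binomial (suc a) (suc b) = begin
  Mᶜ.rec (3 + a ∷ 3 + b ∷ [])
    ≡⟨ Mᶜ.rec-lowerings (3 + a) (3 + b) [] ⟩
  Mᶜ.rec (lower (3 + a) [ 3 + b ]) + (Mᶜ.rec (3 + a ∷ lower (3 + b) []) + 0) + 0
    ≡⟨ cong₂ (λ s t → s + (t + 0) + 0)
         (trans (cong Mᶜ.rec (sym (keep3-∷ (2 + a) [ 3 + b ]))) (M-binomial a (suc b)))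
         (trans (cong (λ L → Mᶜ.rec (3 + a ∷ L)) (++-identityʳ (keep3 [ 2 + b ]))) (M-binomial (suc a) b)) ⟩
  (a + (3 + b)) C (suc a) + ((suc a + (2 + b)) C (2 + a) + 0) + 0
    ≡⟨ +-identityʳ _ ⟩
  (a + (3 + b)) C (suc a) + ((suc a + (2 + b)) C (2 + a) + 0)
    ≡⟨ cong ((a + (3 + b)) C (suc a) +_) (trans (+-identityʳ _) (cong (_C (2 + a)) (sym (+-suc a (2 + b))))) ⟩
  (a + (3 + b)) C (suc a) + (a + (3 + b)) C (2 + a)
    ≡⟨ nCk+nC[k+1]≡[n+1]C[k+1] (a + (3 + b)) (suc a) ⟩
  (suc a + (3 + b)) C (2 + a) ∎
  where open ≡-Reasoning

w-short : ∀ n L → length L ≤ 2 → wᶜ.recᶠ n L ≡ 0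
w-short _       []              _                = refl
w-short _       (_ ∷ [])        _                = refl
w-short zero    (_ ∷ _ ∷ [])    _                = refl
w-short (suc n) (x ∷ y ∷ [])    _                =
  cong₂ (λ s t → s + (t + 0) + 0) (w-short n (lower x [ y ]) (length-lower x [ y ]))
                                  (w-short n (x ∷ lower y []) (s≤s (length-lower y [])))
w-short _       (_ ∷ _ ∷ _ ∷ _) (s≤s (s≤s ()))

prop-i : Prop-i M w
prop-i k@(suc (suc a) ∷ suc (suc b) ∷ []) (s≤s (s≤s z≤n) ∷ s≤s (s≤s z≤n) ∷ []) =
  M-binomial a b , w-short _ (canon k) (length-filter (3 ≤?_) (toList k))

prop-ii : Prop-ii M w
prop-ii _ _ k _ p = cong Mᶜ.rec (canon-insert2 k p) , cong wᶜ.rec (canon-insert2 k p)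

prop-iii : Prop-iii M w
prop-iii (suc (suc r)) (s≤s (s≤s z≤n)) k k≥3 = trans (Mᶜ.rec-canon k k≥3) (+-identityʳ _) , wᶜ.rec-canon k k≥3

toList-tabulate-punchIn : ∀ {n} (g : Fin (suc n) → ℕ) i →
                          toList (tabulate g) ↭ g i ∷ toList (tabulate (g ∘ punchIn i))
toList-tabulate-punchIn g           zero    = ↭-refl
toList-tabulate-punchIn {suc _} g (suc i) =
  ↭-trans (prep (g zero) (toList-tabulate-punchIn (g ∘ suc) i)) (swap (g zero) (g (suc i)) ↭-refl)

toList-tabulate-permute : ∀ {n} (f : Fin n → ℕ) (π : Permutation′ n) →
                          toList (tabulate (f ∘ (π ⟨$⟩ʳ_))) ↭ toList (tabulate f)
toList-tabulate-permute {zero}  f π = ↭-refl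
toList-tabulate-permute {suc _} f π = ↭-trans (toList-tabulate-punchIn (f ∘ (π ⟨$⟩ʳ_)) i)
  (↭-trans (↭-reflexive (cong₂ _∷_ (cong f (inverseʳ π))
                                    (cong toList (tabulate-cong (λ j → cong f (punchIn-permute′ π zero j))))))
           (prep (f zero) (toList-tabulate-permute (f ∘ suc) (remove i π))))
  where i = π ⟨$⟩ˡ zero

canon-permute : ∀ {r} (π : Permutation′ r) (k : Vec ℕ r) → canon (permute π k) ↭ canon k
canon-permute π k = filter-↭ (3 ≤?_)
  (↭-trans (toList-tabulate-permute (lookup k) π) (↭-reflexive (cong toList (tabulate∘lookup k))))

permutation-invariant : ∀ r → 2 ≤ r → (π : Permutation′ r) → (k : Vec ℕ r) → AllGe 2 k →
                        (M r (permute π k) ≡ M r k) × (w r (permute π k) ≡ w r k)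
permutation-invariant _ _ π k _ = Mᶜ.rec-↭ (canon-permute π k) , wᶜ.rec-↭ (canon-permute π k)


-- Uniqueness

sum-insertAt : ∀ {r} (k : Vec ℕ r) p x → sum (insertAt k p x) ≡ x + sum k
sum-insertAt k       zero    x = refl
sum-insertAt (y ∷ k) (suc p) x = trans (cong (y +_) (sum-insertAt k p x)) (x∙yz≈y∙xz y x (sum k))

sum-decAt : ∀ {r} (k : Vec ℕ r) i → 1 ≤ lookup k i → sum (decAt k i) < sum k
sum-decAt (suc _ ∷ _) zero    _    = ≤-refl
sum-decAt (x ∷ k)     (suc i) kᵢ≥1 = +-monoʳ-< x (sum-decAt k i kᵢ≥1)

decAt-all≥2 : ∀ {r} {k : Vec ℕ r} → AllGe 2 k → ∀ i → 3 ≤ lookup k i → AllGe 2 (decAt k i)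
decAt-all≥2 (_    ∷ k≥2) zero    (s≤s x≥2) = x≥2 ∷ k≥2
decAt-all≥2 (x≥2 ∷ k≥2) (suc i) kᵢ≥3      = x≥2 ∷ decAt-all≥2 k≥2 i kᵢ≥3

two-or-all≥3 : ∀ {r} (k : Vec ℕ (suc r)) → AllGe 2 k →
               (∃ λ p → ∃ λ k′ → k ≡ insertAt k′ p 2 × AllGe 2 k′) ⊎ AllGe 3 k
two-or-all≥3         (2 ∷ k)                     (_ ∷ k≥2) = inj₁ (zero , k , refl , k≥2)
two-or-all≥3         (1 ∷ _)                     (s≤s () ∷ _)
two-or-all≥3 {zero}  (suc (suc (suc _)) ∷ [])    _         = inj₂ (s≤s (s≤s (s≤s z≤n)) ∷ [])
two-or-all≥3 {suc _} (x@(suc (suc (suc _))) ∷ k) (x≥2 ∷ k≥2) with two-or-all≥3 k k≥2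
... | inj₁ (p , k′ , refl , k′≥2) = inj₁ (suc p , x ∷ k′ , refl , x≥2 ∷ k′≥2)
... | inj₂ k≥3                    = inj₂ (s≤s (s≤s (s≤s z≤n)) ∷ k≥3)

record Recurrences (base : Vec ℕ 2 → ℕ) (step : (r : ℕ) → Vec ℕ r → ℕ) (F : Family) : Set where
  field
    at-rank-2 : (k : Vec ℕ 2) → AllGe 2 k → F 2 k ≡ base k
    insert-2  : (r : ℕ) → 2 ≤ r → (k : Vec ℕ r) → AllGe 2 k → (p : Fin (suc r)) →
                F (suc r) (insertAt k p 2) ≡ F r k
    lowering  : (r : ℕ) → 2 ≤ r → (k : Vec ℕ r) → AllGe 3 k →
                F r k ≡ step r (tabulate (λ i → F r (decAt k i)))

recurrences-unique : ∀ {base step F F′} → Recurrences base step F → Recurrences base step F′ →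
                     (r : ℕ) → 2 ≤ r → (k : Vec ℕ r) → AllGe 2 k → F r k ≡ F′ r k
recurrences-unique {step = step} {F} {F′} F-rec F′-rec r r≥2 k k≥2 =
  below (suc (sum k)) r r≥2 k k≥2 ≤-refl
  where
  open Recurrences F-rec renaming (at-rank-2 to F-base; insert-2 to F-insert; lowering to F-lower)
  open Recurrences F′-rec renaming (at-rank-2 to F′-base; insert-2 to F′-insert; lowering to F′-lower)
  below : ∀ n r → 2 ≤ r → (k : Vec ℕ r) → AllGe 2 k → sum k < n → F r k ≡ F′ r k
  below (suc n) 1 (s≤s ()) _ _ _
  below (suc n) 2 _ k k≥2 _ = trans (F-base k k≥2) (sym (F′-base k k≥2))
  below (suc n) r@(suc (suc (suc r′))) r≥2 k k≥2 (s≤s k≤n) with two-or-all≥3 k k≥2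
  ... | inj₁ (p , k′ , refl , k′≥2) = begin
    F r (insertAt k′ p 2)   ≡⟨ F-insert _ (s≤s (s≤s z≤n)) k′ k′≥2 p ⟩
    F (2 + r′) k′           ≡⟨ below n _ (s≤s (s≤s z≤n)) k′ k′≥2 k′<n ⟩
    F′ (2 + r′) k′          ≡⟨ F′-insert _ (s≤s (s≤s z≤n)) k′ k′≥2 p ⟨
    F′ r (insertAt k′ p 2)  ∎
    where open ≡-Reasoning
          k′<n : sum k′ < n
          k′<n = <-≤-trans (m<n+m (sum k′) (s≤s z≤n)) (≤-trans (≤-reflexive (sym (sum-insertAt k′ p 2))) k≤n)
  ... | inj₂ k≥3 = begin
    F r k                                        ≡⟨ F-lower r r≥2 k k≥3 ⟩
    step r (tabulate (λ i → F r (decAt k i)))    ≡⟨ cong (step r) (tabulate-cong λ i →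
      below n r r≥2 (decAt k i) (decAt-all≥2 k≥2 i (kᵢ≥3 i))
        (<-≤-trans (sum-decAt k i (≤-trans (s≤s z≤n) (kᵢ≥3 i))) k≤n)) ⟩
    step r (tabulate (λ i → F′ r (decAt k i)))   ≡⟨ F′-lower r r≥2 k k≥3 ⟨
    F′ r k                                       ∎
    where open ≡-Reasoning
          kᵢ≥3 : ∀ i → 3 ≤ lookup k i
          kᵢ≥3 = lookup⁺ k≥3

binomial : Vec ℕ 2 → ℕ
binomial k = (lookup k zero + lookup k (suc zero) ∸ 2) C (lookup k zero ∸ 1)

satisfies⇒recurrencesᴹ : ∀ {M w} → Satisfies M w → Recurrences binomial (λ _ → sum) M
satisfies⇒recurrencesᴹ (i , ii , iii) = record
  { at-rank-2 = λ k k≥2 → proj₁ (i k k≥2)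
  ; insert-2  = λ r r≥2 k k≥2 p → proj₁ (ii r r≥2 k k≥2 p)
  ; lowering  = λ r r≥2 k k≥3 → proj₁ (iii r r≥2 k k≥3)
  }

satisfies⇒recurrencesʷ : ∀ {M w} → Satisfies M w → Recurrences (λ _ → 0) (λ r v → sum v + (r ∸ 2)) w
satisfies⇒recurrencesʷ (i , ii , iii) = record
  { at-rank-2 = λ k k≥2 → proj₂ (i k k≥2)
  ; insert-2  = λ r r≥2 k k≥2 p → proj₂ (ii r r≥2 k k≥2 p)
  ; lowering  = λ r r≥2 k k≥3 → proj₂ (iii r r≥2 k k≥3)
  }

satisfies-unique : ∀ {M w M′ w′} → Satisfies M w → Satisfies M′ w′ →
                   (r : ℕ) → 2 ≤ r → (k : Vec ℕ r) → AllGe 2 k → (M′ r k ≡ M r k) × (w′ r k ≡ w r k)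
satisfies-unique sat sat′ r r≥2 k k≥2 =
  recurrences-unique (satisfies⇒recurrencesᴹ sat′) (satisfies⇒recurrencesᴹ sat) r r≥2 k k≥2 ,
  recurrences-unique (satisfies⇒recurrencesʷ sat′) (satisfies⇒recurrencesʷ sat) r r≥2 k k≥2


-- The Ramsey bound

u-lowerings : ∀ {L} → All≥3 L → uᶜ.rec L ≡ suc (∑ (map uᶜ.rec (lowerings L)))
u-lowerings {[]}        []                                 = refl
u-lowerings {_ ∷ []}    (s≤s (s≤s (s≤s {n = zero} _)) ∷ [])  = refl
u-lowerings {_ ∷ []}    (s≤s (s≤s (s≤s {n = suc _} _)) ∷ []) = cong suc (sym (+-identityʳ _))
u-lowerings {x ∷ y ∷ L} _                                  = trans (uᶜ.rec-lowerings x y L) (+-comm _ 1)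

M≡w+1+u : ∀ {L} → All≥3 L → Mᶜ.rec L ≡ wᶜ.rec L + suc (uᶜ.rec L)
M≡w+1+u {L} L≥3 = below (suc (size L)) L ≤-refl L≥3
  where
  below : ∀ n L → size L < n → All≥3 L → Mᶜ.rec L ≡ wᶜ.rec L + suc (uᶜ.rec L)
  below _       []          _         _              = refl
  below _       (_ ∷ [])    _         (s≤s _ ∷ [])   = refl
  below (suc n) L₀@(x ∷ y ∷ L) (s≤s L₀≤n) L₀≥3 = begin
    Mᶜ.rec L₀                                              ≡⟨ Mᶜ.rec-lowerings x y L ⟩
    ∑ (map Mᶜ.rec ds) + 0                                  ≡⟨ cong (λ s → ∑ s + 0) (map-cong-local IH) ⟩
    ∑ (map (λ D → wᶜ.rec D + suc (uᶜ.rec D)) ds) + 0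
      ≡⟨ cong (_+ 0) (trans (∑-map-+ wᶜ.rec (suc ∘ uᶜ.rec) ds)
                            (cong (∑ (map wᶜ.rec ds) +_) (∑-map-suc uᶜ.rec ds))) ⟩
    ∑ (map wᶜ.rec ds) + (length ds + ∑ (map uᶜ.rec ds)) + 0
      ≡⟨ cong (λ l → ∑ (map wᶜ.rec ds) + (l + ∑ (map uᶜ.rec ds)) + 0) (length-lowerings L₀) ⟩
    ∑ (map wᶜ.rec ds) + (2 + length L + ∑ (map uᶜ.rec ds)) + 0
      ≡⟨ rearrange (∑ (map wᶜ.rec ds)) (length L) (∑ (map uᶜ.rec ds)) ⟩
    ∑ (map wᶜ.rec ds) + length L + suc (∑ (map uᶜ.rec ds) + 1)
      ≡⟨ cong₂ (λ a b → a + suc b) (wᶜ.rec-lowerings x y L) (uᶜ.rec-lowerings x y L) ⟨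
    wᶜ.rec L₀ + suc (uᶜ.rec L₀)                            ∎
    where
    open ≡-Reasoning
    ds = lowerings L₀
    IH : All (λ D → Mᶜ.rec D ≡ wᶜ.rec D + suc (uᶜ.rec D)) ds
    IH = All.zipWith (λ {D} (D<L₀ , D≥3) → below n D (<-≤-trans D<L₀ L₀≤n) D≥3)
                     (lowerings-smaller L₀ , lowerings-all≥3 L₀≥3)
    rearrange : ∀ a b c → a + (2 + b + c) + 0 ≡ a + b + suc (c + 1)
    rearrange = solve-∀

Clique : ∀ {N r} → (Fin N → Fin N → Fin r) → ℕ → Fin r → Set
Clique {N} c m i = Σ (Fin m → Fin N) λ f → Injective _≡_ _≡_ f × (∀ a b → a ≢ b → c (f a) (f b) ≡ i)

restrict : ∀ {N N′ r} → (Fin N → Fin N → Fin r) → (Fin N′ → Fin N) → Fin N′ → Fin N′ → Fin r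
restrict c h a b = c (h a) (h b)

clique-pullback : ∀ {N N′ r m i} (c : Fin N → Fin N → Fin r) {h : Fin N′ → Fin N} → Injective _≡_ _≡_ h →
                  Clique (restrict c h) m i → Clique c m i
clique-pullback c {h} h-inj (f , f-inj , f-mono) = h ∘ f , f-inj ∘ h-inj , f-mono

clique-cone : ∀ {N N′ r m i} (c : Fin (suc N) → Fin (suc N) → Fin r) → (∀ x y → c x y ≡ c y x) →
              (h : Fin N′ → Fin N) → Injective _≡_ _≡_ h → (∀ a → c zero (suc (h a)) ≡ i) →
              Clique (restrict c (suc ∘ h)) m i → Clique c (suc m) i
clique-cone {i = i} c c-sym h h-inj apex (f , f-inj , f-mono) =
  lift 1 (h ∘ f) , lift-injective (h ∘ f) (f-inj ∘ h-inj) 1 , mono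
  where
  mono : ∀ a b → a ≢ b → c (lift 1 (h ∘ f) a) (lift 1 (h ∘ f) b) ≡ i
  mono zero    zero    a≢b = ⊥-elim (a≢b refl)
  mono zero    (suc b) _   = apex (f b)
  mono (suc a) zero    _   = trans (c-sym _ _) (apex (f a))
  mono (suc a) (suc b) a≢b = f-mono a b (a≢b ∘ cong suc)

ColourClass≥ : ∀ {m r} → (Fin m → Fin r) → Fin r → ℕ → Set
ColourClass≥ {m} col i n = Σ (Fin n → Fin m) λ g → Injective _≡_ _≡_ g × (∀ a → col (g a) ≡ i)

colourClass-∅ : ∀ {m r} {col : Fin m → Fin r} {i} → ColourClass≥ col i 0
colourClass-∅ = (λ ()) , (λ {}) , λ ()

colourClass-cons : ∀ {m r n} {col : Fin (suc m) → Fin r} {i} → col zero ≡ i →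
                   ColourClass≥ (col ∘ suc) i n → ColourClass≥ col i (suc n)
colourClass-cons col₀≡i (g , g-inj , g-col) =
  lift 1 g , lift-injective g g-inj 1 , λ { zero → col₀≡i ; (suc a) → g-col a }

colourClass-tail : ∀ {m r n} {col : Fin (suc m) → Fin r} {i} → ColourClass≥ (col ∘ suc) i n → ColourClass≥ col i n
colourClass-tail (g , g-inj , g-col) = suc ∘ g , g-inj ∘ suc-injective , g-col

pigeonhole : ∀ {m r} (col : Fin m → Fin r) (us : Vec ℕ r) → sum us < m →
             ∃ λ i → ColourClass≥ col i (suc (lookup us i))
pigeonhole {suc m} col us us<m with lookup us (col zero) in u₀≡
... | zero  = col zero , subst (ColourClass≥ col (col zero) ∘ suc) (sym u₀≡)
                               (colourClass-cons {col = col} refl (colourClass-∅ {col = col ∘ suc}))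
... | suc _ with pigeonhole (col ∘ suc) (decAt us (col zero))
                   (<-≤-trans (sum-decAt us (col zero) (subst (1 ≤_) (sym u₀≡) (s≤s z≤n))) (s≤s⁻¹ us<m))
...   | i , class with i ≟ col zero
...     | yes refl = i , subst (ColourClass≥ col i ∘ suc)
                               (trans (cong suc (trans (lookup∘updateAt i us) (cong pred u₀≡))) (sym u₀≡))
                               (colourClass-cons {col = col} refl class)
...     | no i≢c₀  = i , subst (ColourClass≥ col i ∘ suc) (lookup∘updateAt′ i (col zero) i≢c₀ us)
                               (colourClass-tail {col = col} class)

arrows-one : ∀ {N r} (k : Vec ℕ r) i → lookup k i ≡ 1 → Arrows (suc N) r k
arrows-one k i kᵢ≡1 (c , _) = i , subst (λ m → Clique c m i) (sym kᵢ≡1) ((λ _ → zero) , single-inj , single-mono)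
  where
  single-inj : Injective _≡_ _≡_ (λ (_ : Fin 1) → zero)
  single-inj {zero} {zero} _ = refl
  single-mono : ∀ (a b : Fin 1) → a ≢ b → c zero zero ≡ i
  single-mono zero zero 0≢0 = ⊥-elim (0≢0 refl)

arrows-step : ∀ {r} (k : Vec ℕ r) → AllGe 1 k → (us : Vec ℕ r) →
              (∀ i → Arrows (suc (lookup us i)) r (decAt k i)) → Arrows (suc (suc (sum us))) r k
arrows-step k k≥1 us arrows (c , c-sym) with pigeonhole (λ v → c zero (suc v)) us ≤-refl
... | i , g , g-inj , g-col with arrows i (restrict c (suc ∘ g) , λ a b → c-sym _ _)
...   | j , clique with j ≟ i
...     | yes refl = i , subst (λ m → Clique c m i) (suc-pred (lookup k i) {{>-nonZero (lookup⁺ k≥1 i)}})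
                           (clique-cone c c-sym g g-inj g-col
                             (subst (λ m → Clique (restrict c (suc ∘ g)) m i) (lookup∘updateAt i k) clique))
...     | no j≢i   = j , clique-pullback c (g-inj ∘ suc-injective)
                           (subst (λ m → Clique (restrict c (suc ∘ g)) m j) (lookup∘updateAt′ j i j≢i k) clique)

arrows-bound : ∀ {r} (k : Vec ℕ r) → AllGe 2 k → Arrows (suc (uᶜ.rec (canon k))) r k
arrows-bound k k≥2 = below (suc (sum k)) k k≥2 ≤-refl
  where
  below : ∀ n {r} (k : Vec ℕ r) → AllGe 2 k → sum k < n → Arrows (suc (uᶜ.rec (canon k))) r k
  below (suc n) {r} k k≥2 (s≤s k≤n) =
    subst (λ N → Arrows N r k) (cong suc bound≡)
          (arrows-step k (VAll.map (≤-trans (s≤s z≤n)) k≥2) us λ i →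
             subst (λ u → Arrows (suc u) r (decAt k i)) (sym (lookup∘tabulate _ i)) (weighted i))
    where
    us = tabulate (loweringWeight uᶜ.rec k)
    bound≡ : suc (sum us) ≡ uᶜ.rec (canon k)
    bound≡ = trans (cong suc (sum-loweringWeight uᶜ.rec k)) (sym (u-lowerings (all-filter (3 ≤?_) (toList k))))
    weighted : ∀ i → Arrows (suc (loweringWeight uᶜ.rec k i)) r (decAt k i)
    weighted i with lookup k i in kᵢ≡ | lookup⁺ k≥2 i
    ... | 1                 | s≤s ()
    ... | 2                 | _ = arrows-one (decAt k i) i (trans (lookup∘updateAt i k) (cong pred kᵢ≡))
    ... | suc (suc (suc _)) | _ = below n (decAt k i) (decAt-all≥2 k≥2 i kᵢ≥3)
                                    (<-≤-trans (sum-decAt k i (≤-trans (s≤s z≤n) kᵢ≥3)) k≤n)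
      where kᵢ≥3 : 3 ≤ lookup k i
            kᵢ≥3 = subst (3 ≤_) (sym kᵢ≡) (s≤s (s≤s (s≤s z≤n)))


-- Existence of Ramsey numbers

-- Without function extensionality, searching a space of functions only decides predicates
-- that respect pointwise equality.
Searchable : (A : Set) → (A → A → Set) → Set₁
Searchable A _≈_ = (P : A → Set) → P Respects _≈_ → Decidable P → Dec (∃ P)

searchFin : ∀ {n} → Searchable (Fin n) _≡_
searchFin _ _ P? = any? P?

searchVector : ∀ {B : Set} {_≈_ : B → B → Set} → Reflexive _≈_ → Searchable B _≈_ →
               ∀ n → Searchable (Vector B n) (Pointwise _≈_)
searchVector refl≈ search zero    P resp P? =
  map′ (λ P[] → []ᶠ , P[]) (λ (v , Pv) → resp (λ ()) Pv) (P? []ᶠ)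
searchVector {_≈_ = _≈_} refl≈ search (suc n) P resp P? =
  map′ (λ (b , v , Pbv) → b ∷ᶠ v , Pbv) (λ (v , Pv) → head v , tail v , resp head∷tail Pv) (search Q resp-Q Q?)
  where
  Q : _ → Set
  Q b = ∃ λ v → P (b ∷ᶠ v)
  resp-Q : Q Respects _
  resp-Q b≈b′ (v , Pbv) = v , resp (λ { zero → b≈b′ ; (suc i) → refl≈ }) Pbv
  Q? : Decidable Q
  Q? b = searchVector refl≈ search n (P ∘ (b ∷ᶠ_))
                      (λ v≈v′ → resp λ { zero → refl≈ ; (suc i) → v≈v′ i }) (P? ∘ (b ∷ᶠ_))
  head∷tail : ∀ {v} → Pointwise _≈_ v (head v ∷ᶠ tail v)
  head∷tail zero    = refl≈
  head∷tail (suc i) = refl≈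

searchable⇒∀? : ∀ {A : Set} {_≈_ : A → A → Set} → Searchable A _≈_ → Symmetric _≈_ →
                (P : A → Set) → P Respects _≈_ → Decidable P → Dec (∀ a → P a)
searchable⇒∀? search sym≈ P resp P? =
  map′ (λ ∄¬P a → decidable-stable (P? a) (λ ¬Pa → ∄¬P (a , ¬Pa))) (λ ∀P (a , ¬Pa) → ¬Pa (∀P a))
       (¬? (search (¬_ ∘ P) (λ a≈b ¬Pa Pb → ¬Pa (resp (sym≈ a≈b) Pb)) (¬? ∘ P?)))

clique? : ∀ {N r} (c : Fin N → Fin N → Fin r) m i → Dec (Clique c m i)
clique? {N} c m i = searchVector refl searchFin m _ respects λ f → injective? f ×-dec monochromatic? f
  where
  respects : (λ f → Injective _≡_ _≡_ f × (∀ a b → a ≢ b → c (f a) (f b) ≡ i)) Respects Pointwise _≡_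
  respects f≗g (f-inj , f-mono) =
    (λ {a} {b} ga≡gb → f-inj (trans (f≗g a) (trans ga≡gb (sym (f≗g b))))) ,
    (λ a b a≢b → trans (cong₂ c (sym (f≗g a)) (sym (f≗g b))) (f-mono a b a≢b))
  injective? : ∀ f → Dec (Injective _≡_ _≡_ f)
  injective? f = map′ (λ h {a} {b} → h a b) (λ h a b → h {a} {b})
                      (all? λ a → all? λ b → f a ≟ f b →-dec a ≟ b)
  monochromatic? : ∀ f → Dec (∀ a b → a ≢ b → c (f a) (f b) ≡ i)
  monochromatic? f = all? λ a → all? λ b → ¬? (a ≟ b) →-dec c (f a) (f b) ≟ i

arrows? : ∀ N r (k : Vec ℕ r) → Dec (Arrows N r k)
arrows? N r k =
  map′ (λ h (c , c-sym) → h c c-sym) (λ h c c-sym → h (c , c-sym))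
       (searchable⇒∀? (searchVector (λ _ → refl) (searchVector refl searchFin N) N) (λ c≈d x y → sym (c≈d x y))
                      Q respects λ c → (all? λ x → all? λ y → c x y ≟ c y x)
                                       →-dec any? λ i → clique? c (lookup k i) i)
  where
  Q : (Fin N → Fin N → Fin r) → Set
  Q c = (∀ x y → c x y ≡ c y x) → HasMonoClique k c
  respects : Q Respects Pointwise (Pointwise _≡_)
  respects c≈d Qc d-sym with Qc (λ x y → trans (c≈d x y) (trans (d-sym x y) (sym (c≈d y x))))
  ... | i , f , f-inj , f-mono = i , f , f-inj , λ a b a≢b → trans (sym (c≈d (f a) (f b))) (f-mono a b a≢b)

Minimum : (ℕ → Set) → ℕ → Set
Minimum P R = P R × (∀ n → P n → R ≤ n)

least : ∀ {P : ℕ → Set} → Decidable P → ∀ {m} → P m → ∃ (Minimum P)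
least {P} P? {m} = <-rec (λ m → P m → ∃ (Minimum P)) step m
  where
  step : ∀ m → (∀ {n} → n < m → P n → ∃ (Minimum P)) → P m → ∃ (Minimum P)
  step m below Pm with anyUpTo? P? m
  ... | yes (n , n<m , Pn) = below n<m Pn
  ... | no ∄n<m            = m , Pm , λ n Pn → ≮⇒≥ (λ n<m → ∄n<m (n , n<m , Pn))

M∸w≡1+u : ∀ {r} (k : Vec ℕ r) → M r k ∸ w r k ≡ suc (uᶜ.rec (canon k))
M∸w≡1+u k = trans (cong (_∸ w _ k) (M≡w+1+u (all-filter (3 ≤?_) (toList k)))) (m+n∸m≡n (w _ k) _)

ramsey-number : (r : ℕ) → 2 ≤ r → (k : Vec ℕ r) → AllGe 2 k →
                Σ ℕ λ R → IsRamseyNumber r k R × (R ≤ M r k ∸ w r k)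
ramsey-number r _ k k≥2 with least (λ N → arrows? N r k) (arrows-bound k k≥2)
... | R , R-minimum = R , R-minimum , subst (R ≤_) (sym (M∸w≡1+u k)) (proj₂ R-minimum _ (arrows-bound k k≥2))

proposition3p2 :
    Σ Family λ M → Σ Family λ w →
      Satisfies M w
      × ((M′ w′ : Family) → Satisfies M′ w′ →
          (r : ℕ) → 2 ≤ r → (k : Vec ℕ r) → AllGe 2 k →
          (M′ r k ≡ M r k) × (w′ r k ≡ w r k))
      × ((r : ℕ) → 2 ≤ r → (π : Permutation′ r) → (k : Vec ℕ r) → AllGe 2 k →
          (M r (permute π k) ≡ M r k) × (w r (permute π k) ≡ w r k))
      × ((r : ℕ) → 2 ≤ r → (k : Vec ℕ r) → AllGe 2 k →
          Σ ℕ λ R → IsRamseyNumber r k R × (R ≤ M r k ∸ w r k))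
proposition3p2 = M , w , satisfies , (λ _ _ → satisfies-unique satisfies) , permutation-invariant , ramsey-number
  where
  satisfies : Satisfies M w
  satisfies = prop-i , prop-ii , prop-iii
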